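{- Let $G$ be a graph. If $G$ fails to be $2s$-repeating for some $s\in\mathbb{N}$, then $G$ fails to be $2r$-repeating for all integers $r\ge s$.
   Context: A walk is an alternating sequence of vertices and edges with each edge preceded and followed by its endpoints; its length is its number of edges; it is closed if its first and last vertices coincide. For $q\in\mathbb{N}$, a closed walk $(v_0,v_1,\dots,v_r=v_0)$ is $q$-repeating if there exist $0\le t<t'\le r-1$ with $t\equiv t'\pmod q$ and $v_t=v_{t'}$. A graph is $q$-repeating if for every integer $j\ge2$, every closed walk on it of length $jq$ is $q$-repeating. -}

module Defs where

open import Data.Nat using (ℕ; zero; suc; _+_; _*_; _<_; _≤_)
open import Data.Fin using (Fin)
open import Data.Product using (_×_; ∃-syntax)
open import Relation.Binary.PropositionalEquality using (_≡_)
open import Relation.Nullary using (¬_)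

record Graph (n : ℕ) : Set₁ where
  field
    Adj    : Fin n → Fin n → Set
    sym    : ∀ {u v} → Adj u v → Adj v u
    irrefl : ∀ {v} → ¬ Adj v v

open Graph public

-- A closed walk of length r in G, given by its vertex sequence
-- w 0, w 1, ..., w r (values of w beyond r are irrelevant).
-- In a simple graph the edge between consecutive vertices is
-- determined by its endpoints, so it is given by the adjacency witness.
IsClosedWalk : ∀ {n} → Graph n → ℕ → (ℕ → Fin n) → Set
IsClosedWalk G r w = (∀ i → i < r → Adj G (w i) (w (suc i))) × (w 0 ≡ w r)

IsRepeatingWalk : ∀ {n} → ℕ → ℕ → (ℕ → Fin n) → Set
IsRepeatingWalk q r w =
  ∃[ t ] ∃[ t' ] ∃[ k ] (t < t' × t' < r × t' ≡ t + k * q × w t ≡ w t')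

IsRepeatingGraph : ∀ {n} → Graph n → ℕ → Set
IsRepeatingGraph G q =
  ∀ (j : ℕ) → 2 ≤ j → ∀ (w : ℕ → Fin _) →
    IsClosedWalk G (j * q) w → IsRepeatingWalk q (j * q) w

module Submission where

-- A closed walk w of length j m (here m = 2 s) is stretched to one of length j (2 d + m)
-- (here 2 r = 2 d + 2 s) by traversing the first edge of each block of m steps d times
-- back and forth before walking the block; the index map is `stretch`, and `pad d` is its
-- shape on one block. Since stretch (i + k (2 d + m)) = stretch i + k m, two visits of the
-- stretched walk congruent modulo 2 d + m are two visits of w congruent modulo m.

open import Defs hiding (sym)
open import Data.Nat using (ℕ; zero; suc; _+_; _*_; _∸_; _≤_; _<_; z<s; NonZero; >-nonZero; >-nonZero⁻¹)
open import Data.Nat.Properties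
open import Data.Nat.DivMod using (_/_; _%_; m≡m%n+[m/n]*n; m%n<n; [m+kn]%n≡m%n; +-distrib-/-∣ʳ; m*n/n≡m; m<n⇒m%n≡m; m<n⇒m/n≡0; m<n*o⇒m/o<n)
open import Data.Nat.Divisibility using (n∣m*n)
open import Data.Fin using (Fin)
open import Data.Product using (_,_)
open import Data.Sum using (_⊎_; inj₁; inj₂)
open import Data.Empty using (⊥-elim)
open import Function using (_∘_)
open import Relation.Nullary using (¬_)
open import Relation.Binary.PropositionalEquality
  using (_≡_; refl; sym; trans; cong; cong₂; subst; module ≡-Reasoning)

Neighbours : ℕ → ℕ → Set
Neighbours x y = suc x ≡ y ⊎ suc y ≡ x

neighbours-+ʳ : ∀ {x y} c → Neighbours x y → Neighbours (x + c) (y + c)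
neighbours-+ʳ c (inj₁ e) = inj₁ (cong (_+ c) e)
neighbours-+ʳ c (inj₂ e) = inj₂ (cong (_+ c) e)

closedWalk-∘ : ∀ {n} (G : Graph n) {L L′ : ℕ} (w : ℕ → Fin n) (f : ℕ → ℕ) →
  IsClosedWalk G L w → f 0 ≡ 0 → f L′ ≡ L →
  (∀ i → i < L′ → f i < L) → (∀ i → Neighbours (f i) (f (suc i))) →
  IsClosedWalk G L′ (w ∘ f)
closedWalk-∘ G {L} {L′} w f (adj , closed) f0≡0 fL′≡L bounded step = edge , ends
  where
  edge : ∀ i → i < L′ → Adj G (w (f i)) (w (f (suc i)))
  edge i i<L′ with step i
  ... | inj₁ e = subst (λ y → Adj G (w (f i)) (w y)) e (adj (f i) (bounded i i<L′))
  ... | inj₂ e = Graph.sym G (subst (λ x → Adj G (w (f (suc i))) (w x)) e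
                   (adj (f (suc i)) (subst (_≤ L) (sym e) (<⇒≤ (bounded i i<L′)))))

  ends : w (f 0) ≡ w (f L′)
  ends = trans (cong w f0≡0) (trans closed (cong w (sym fL′≡L)))

repeatingWalk-∘ : ∀ {n} {q q′ L L′ : ℕ} (w : ℕ → Fin n) (f : ℕ → ℕ) → 0 < q →
  (∀ i k → f (i + k * q′) ≡ f i + k * q) → (∀ i → i < L′ → f i < L) →
  IsRepeatingWalk q′ L′ (w ∘ f) → IsRepeatingWalk q L w
repeatingWalk-∘ w f 0<q f-+ bounded (t , t′ , zero , t<t′ , _ , t′≡t+0 , _) =
  ⊥-elim (<-irrefl (sym (trans t′≡t+0 (+-identityʳ t))) t<t′)
repeatingWalk-∘ {q = q} w f 0<q f-+ bounded (t , t′ , suc k , _ , t′<L′ , t′≡ , eq) =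
  f t , f t′ , suc k , ft<ft′ , bounded t′ t′<L′ , ft′≡ , eq
  where
  ft′≡ : f t′ ≡ f t + suc k * q
  ft′≡ = trans (cong f t′≡) (f-+ t (suc k))

  ft<ft′ : f t < f t′
  ft<ft′ = subst (f t <_) (sym ft′≡) (m<m+n (f t) (<-≤-trans 0<q (m≤m+n q (k * q))))

pad : ℕ → ℕ → ℕ
pad zero    a             = a
pad (suc d) zero          = 0
pad (suc d) (suc zero)    = 1
pad (suc d) (suc (suc a)) = pad d a

pad-zero : ∀ d → pad d 0 ≡ 0
pad-zero zero    = refl
pad-zero (suc d) = refl

pad-2*d+ : ∀ d c → pad d (2 * d + c) ≡ c
pad-2*d+ zero    c = refl
pad-2*d+ (suc d) c = subst (λ x → pad (suc d) (x + c) ≡ c) (sym (*-suc 2 d)) (pad-2*d+ d c)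

pad-neighbours : ∀ d a → Neighbours (pad d a) (pad d (suc a))
pad-neighbours zero    a             = inj₁ refl
pad-neighbours (suc d) zero          = inj₁ refl
pad-neighbours (suc d) (suc zero)    = inj₂ (cong suc (pad-zero d))
pad-neighbours (suc d) (suc (suc a)) = pad-neighbours d a

pad-< : ∀ d {m a} → 1 < m → a < 2 * d + m → pad d a < m
pad-< zero                        _   a<m = a<m
pad-< (suc d) {a = zero}          1<m _   = <-trans z<s 1<m
pad-< (suc d) {a = suc zero}      1<m _   = 1<m
pad-< (suc d) {m} {suc (suc a)}   1<m a<  =
  pad-< d 1<m (≤-pred (≤-pred (subst (λ x → suc (suc a) < x + m) (*-suc 2 d) a<)))

pad-last : ∀ d {a m} → 0 < m → suc a ≡ 2 * d + m → suc (pad d a) ≡ m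
pad-last d {m = suc μ} _ e =
  cong suc (trans (cong (pad d) (suc-injective (trans e (+-suc (2 * d) μ)))) (pad-2*d+ d μ))

module Stretch (d m : ℕ) (1<m : 1 < m) where

  R : ℕ
  R = 2 * d + m

  0<m : 0 < m
  0<m = <-trans z<s 1<m

  instance
    R-nonZero : NonZero R
    R-nonZero = >-nonZero (<-≤-trans 0<m (m≤n+m m (2 * d)))

  stretch : ℕ → ℕ
  stretch i = pad d (i % R) + (i / R) * m

  stretch-+ : ∀ i k → stretch (i + k * R) ≡ stretch i + k * m
  stretch-+ i k = begin
    pad d ((i + k * R) % R) + ((i + k * R) / R) * m
      ≡⟨ cong₂ (λ a b → pad d a + b * m) ([m+kn]%n≡m%n i k R) quotient ⟩
    pad d (i % R) + (i / R + k) * m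
      ≡⟨ cong (pad d (i % R) +_) (*-distribʳ-+ m (i / R) k) ⟩
    pad d (i % R) + ((i / R) * m + k * m)
      ≡⟨ sym (+-assoc (pad d (i % R)) _ _) ⟩
    stretch i + k * m ∎
    where
    open ≡-Reasoning
    quotient : (i + k * R) / R ≡ i / R + k
    quotient = trans (+-distrib-/-∣ʳ i (n∣m*n k)) (cong (i / R +_) (m*n/n≡m k R))

  stretch-block : ∀ {a} b → a < R → stretch (a + b * R) ≡ pad d a + b * m
  stretch-block {a} b a<R = trans (stretch-+ a b) (cong (_+ b * m) stretch-a)
    where
    stretch-a : stretch a ≡ pad d a
    stretch-a = trans (cong₂ (λ x y → pad d x + y * m) (m<n⇒m%n≡m a<R) (m<n⇒m/n≡0 a<R))
                      (+-identityʳ (pad d a))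

  stretch-0 : stretch 0 ≡ 0
  stretch-0 = trans (stretch-block 0 (>-nonZero⁻¹ R)) (trans (+-identityʳ (pad d 0)) (pad-zero d))

  stretch-< : ∀ j i → i < j * R → stretch i < j * m
  stretch-< j i i<jR = begin-strict
    pad d (i % R) + (i / R) * m <⟨ +-monoˡ-< ((i / R) * m) (pad-< d 1<m (m%n<n i R)) ⟩
    suc (i / R) * m             ≤⟨ *-monoˡ-≤ m (m<n*o⇒m/o<n {n = j} i<jR) ⟩
    j * m                       ∎
    where open ≤-Reasoning

  stretch-neighbours : ∀ i → Neighbours (stretch i) (stretch (suc i))
  stretch-neighbours i with m≤n⇒m<n∨m≡n (m%n<n i R)
  ... | inj₁ 1+a<R = subst (Neighbours (stretch i)) (sym next)
                       (neighbours-+ʳ (i / R * m) (pad-neighbours d (i % R)))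
    where
    next : stretch (suc i) ≡ pad d (suc (i % R)) + i / R * m
    next = trans (cong (stretch ∘ suc) (m≡m%n+[m/n]*n i R)) (stretch-block (i / R) 1+a<R)
  ... | inj₂ 1+a≡R = inj₁ (begin
    suc (pad d (i % R)) + i / R * m   ≡⟨ cong (_+ i / R * m) (pad-last d 0<m 1+a≡R) ⟩
    m + i / R * m                     ≡⟨ sym (cong (_+ suc (i / R) * m) (pad-zero d)) ⟩
    pad d 0 + suc (i / R) * m         ≡⟨ sym (stretch-block (suc (i / R)) (>-nonZero⁻¹ R)) ⟩
    stretch (suc (i / R) * R)         ≡⟨ cong stretch next-block ⟩
    stretch (suc i)                   ∎)
    where
    open ≡-Reasoning
    next-block : suc (i / R) * R ≡ suc i
    next-block = sym (trans (cong suc (m≡m%n+[m/n]*n i R)) (cong (_+ i / R * R) 1+a≡R))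

  repeating-stretched⇒repeating : ∀ {n} (G : Graph n) → IsRepeatingGraph G R → IsRepeatingGraph G m
  repeating-stretched⇒repeating G rep j 2≤j w walk =
    repeatingWalk-∘ w stretch 0<m stretch-+ (stretch-< j)
      (rep j 2≤j (w ∘ stretch)
        (closedWalk-∘ G w stretch walk stretch-0 stretch-[j*R] (stretch-< j) stretch-neighbours))
    where
    stretch-[j*R] : stretch (j * R) ≡ j * m
    stretch-[j*R] = trans (stretch-+ 0 j) (cong (_+ j * m) stretch-0)

proposition6 : ∀ (n : ℕ) (G : Graph n) (s : ℕ) → 1 ≤ s →
    ¬ IsRepeatingGraph G (2 * s) →
    ∀ (r : ℕ) → s ≤ r → ¬ IsRepeatingGraph G (2 * r)
proposition6 n G s 1≤s ¬rep[2s] r s≤r rep[2r] =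
  ¬rep[2s] (Stretch.repeating-stretched⇒repeating (r ∸ s) (2 * s) 1<2s G
             (subst (IsRepeatingGraph G) 2r≡2[r∸s]+2s rep[2r]))
  where
  1<2s : 1 < 2 * s
  1<2s = *-monoʳ-≤ 2 1≤s

  2r≡2[r∸s]+2s : 2 * r ≡ 2 * (r ∸ s) + 2 * s
  2r≡2[r∸s]+2s = trans (cong (2 *_) (sym (m∸n+n≡m s≤r))) (*-distribˡ-+ 2 (r ∸ s) s)
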